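{- Let $r,s\in\mathbb{N}_{\ge2}$, let $r=p_1^{\alpha_1}\cdots p_m^{\alpha_m}$ be the prime factorization of $r$, ordered so that $p_1,\ldots,p_k$ are exactly the prime factors of $t=\gcd(r,s)$, where $0<k<m$. Let $u=p_1^{\alpha_1}\cdots p_k^{\alpha_k}$. Let $d\in\mathbb{N}_{>0}$. Then $u^{ -d}$ is the $<$-smallest element $x$ of $D_u\setminus\{0\}$ such that $\tau_r(x)=r^{ -d}$.
   Context: For $q\in\mathbb{N}_{\ge2}$, $D_q$ is the set of numbers in $[0,1)$ admitting a finite base $q$ expansion. For nonzero $x\in D_r$, $\tau_r(x)$ is the least $v\in r^{ -\mathbb{N}_{>0}}$ appearing with nonzero coefficient in the finite base $r$ expansion of $x$. -}

module Defs where

open import Data.Nat using (ℕ; zero; suc; _^_; _≤_; _<_)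
open import Data.Fin using (Fin)
import Data.Fin as Fin
open import Data.Integer using (+_)
open import Data.Rational using (ℚ; 0ℚ; 1ℚ; _+_; _*_; _/_)
import Data.Rational as ℚ
open import Data.Product using (Σ; _×_)
open import Relation.Binary.PropositionalEquality using (_≡_; _≢_)
import Data.Nat as ℕ

prodFin : (m : ℕ) → (Fin m → ℕ) → ℕ
prodFin zero    f = 1
prodFin (suc m) f = f Fin.zero ℕ.* prodFin m (λ i → f (Fin.suc i))

-- recip n = 1/n as a rational (with the junk value recip 0 = 0)
recip : ℕ → ℚ
recip zero    = 0ℚ
recip (suc n) = + 1 / suc n

expVal : (q : ℕ) → (ℕ → ℕ) → ℕ → ℚ
expVal q c zero    = 0ℚ
expVal q c (suc n) = expVal q c n + (+ c (suc n) / 1) * recip (q ^ suc n)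

IsExpansion : (q : ℕ) → ℚ → (n : ℕ) → (ℕ → ℕ) → Set
IsExpansion q x n c = (∀ j → 1 ≤ j → j ≤ n → c j < q) × (x ≡ expVal q c n)

D : ℕ → ℚ → Set
D q x = (0ℚ ℚ.≤ x) × (x ℚ.< 1ℚ) × Σ ℕ (λ n → Σ (ℕ → ℕ) (λ c → IsExpansion q x n c))

-- TauIs r x d  means  x ∈ D_r and τ_r(x) = r^{-d}  (d ≥ 1): in the finite
-- base-r expansion of x, the digit at r^{-d} is nonzero and all digits at
-- r^{-j}, j > d, are zero (so r^{-d} is the least power appearing).
TauIs : ℕ → ℚ → ℕ → Set
TauIs r x d =
  (0ℚ ℚ.≤ x) × (x ℚ.< 1ℚ) × (1 ≤ d) ×
  Σ ℕ (λ n → Σ (ℕ → ℕ) (λ c →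
    IsExpansion r x n c × (d ≤ n) × (c d ≢ 0) ×
    (∀ j → d < j → j ≤ n → c j ≡ 0)))

-- Split r = u · v with u, v coprime. Then u^(-d) = v^d / r^d, and the last of the d base-r
-- digits of v^d is v^d mod r ≠ 0 because u ∤ v^d; so τ_r(u^(-d)) = r^(-d). Conversely, if x ∈ D_u
-- has τ_r(x) = r^(-d), then x = A / u^n = B / r^d, i.e. A u^d v^d = B u^n; as v^d is coprime to
-- u^n it divides B ≠ 0, whence x = B / r^d ≥ v^d / r^d = u^(-d).

module Submission where

open import Defs
open import Data.Nat using (ℕ; zero; suc; _+_; _*_; _^_; _∸_; _/_; _%_; _≤_; _<_; _<ᵇ_; z≤n; s≤s; z<s; NonZero; >-nonZero; ≢-nonZero; nonTrivial⇒n>1)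
import Data.Nat.Properties as ℕ
open import Data.Nat.DivMod using (m≡m%n+[m/n]*n; m%n<n; m/n/o≡m/[n*o]; /-congʳ; n/1≡n; m<n⇒m/n≡0)
open import Data.Nat.Divisibility using (_∣_; divides; ∣-trans; ∣-refl; ∣⇒≤; ∣1⇒≡1; m%n≡0⇒n∣m)
open import Data.Nat.Coprimality using (Coprime; coprime-divisor)
import Data.Nat.Coprimality as Coprime
open import Data.Nat.GCD using (gcd)
open import Data.Nat.Primality using (Prime; prime⇒irreducible; prime⇒nonZero; prime⇒nonTrivial)
open import Data.Nat.Tactic.RingSolver using (solve-∀)
open import Data.Integer as ℤ using (+_; +≤+; +<+)
import Data.Integer.Properties as ℤ
open import Data.Rational using (ℚ; 0ℚ; 1ℚ; toℚᵘ) renaming (_/_ to _/ℚ_; _≤_ to _≤ℚ_; _<_ to _<ℚ_; _+_ to _+ℚ_; _*_ to _*ℚ_)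
import Data.Rational.Properties as ℚ
open import Data.Rational.Properties using (normalize-injective-≃; toℚᵘ-fromℚᵘ; toℚᵘ-injective; toℚᵘ-cancel-≤; toℚᵘ-cancel-<; toℚᵘ-homo-+; toℚᵘ-homo-*)
open import Data.Rational.Unnormalised as ℚᵘ using (*≡*; *≤*; *<*) renaming (_/_ to _/ᵘ_)
import Data.Rational.Unnormalised.Properties as ℚᵘ
open import Data.Fin using (Fin; toℕ)
import Data.Fin as Fin
open import Data.Bool using (true; false; if_then_else_)
open import Data.Bool.Properties using (not-¬)
open import Data.Product using (_×_; _,_; ∃)
open import Data.Sum using (inj₁; inj₂)
open import Data.Empty using (⊥-elim)
open import Function.Bundles using (_⇔_)
open import Function.Definitions using (Injective)
open import Relation.Binary.PropositionalEquality

toℚᵘ-/ : ∀ a b .{{_ : NonZero b}} → toℚᵘ (+ a /ℚ b) ℚᵘ.≃ + a /ᵘ b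
toℚᵘ-/ a (suc b) = toℚᵘ-fromℚᵘ (+ a /ᵘ suc b)

/ᵘ-cross-≃ : ∀ a b c e .{{_ : NonZero b}} .{{_ : NonZero e}} →
             a * e ≡ c * b → + a /ᵘ b ℚᵘ.≃ + c /ᵘ e
/ᵘ-cross-≃ a (suc b) c (suc e) eq = *≡* (subst₂ _≡_ (ℤ.pos-* a _) (ℤ.pos-* c _) (cong +_ eq))

/ᵘ-cross-≤ : ∀ a b c e .{{_ : NonZero b}} .{{_ : NonZero e}} →
             a * e ≤ c * b → + a /ᵘ b ℚᵘ.≤ + c /ᵘ e
/ᵘ-cross-≤ a (suc b) c (suc e) le = *≤* (subst₂ ℤ._≤_ (ℤ.pos-* a _) (ℤ.pos-* c _) (+≤+ le))

/ᵘ-cross-< : ∀ a b c e .{{_ : NonZero b}} .{{_ : NonZero e}} →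
             a * e < c * b → + a /ᵘ b ℚᵘ.< + c /ᵘ e
/ᵘ-cross-< a (suc b) c (suc e) lt = *<* (subst₂ ℤ._<_ (ℤ.pos-* a _) (ℤ.pos-* c _) (+<+ lt))

/ᵘ-+ : ∀ a b c e .{{_ : NonZero b}} .{{_ : NonZero e}} →
       + a /ᵘ b ℚᵘ.+ + c /ᵘ e ℚᵘ.≃ (+ (a * e + c * b) /ᵘ (b * e)) {{ℕ.m*n≢0 b e}}
/ᵘ-+ a (suc b) c (suc e) = ℚᵘ.≃-reflexive (ℚᵘ./-cong numerators refl)
  where
  numerators : + a ℤ.* + suc e ℤ.+ + c ℤ.* + suc b ≡ + (a * suc e + c * suc b)
  numerators = trans (cong₂ ℤ._+_ (sym (ℤ.pos-* a (suc e))) (sym (ℤ.pos-* c (suc b))))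
                     (sym (ℤ.pos-+ (a * suc e) (c * suc b)))

/ᵘ-* : ∀ a b c e .{{_ : NonZero b}} .{{_ : NonZero e}} →
       (+ a /ᵘ b) ℚᵘ.* (+ c /ᵘ e) ℚᵘ.≃ (+ (a * c) /ᵘ (b * e)) {{ℕ.m*n≢0 b e}}
/ᵘ-* a (suc b) c (suc e) = ℚᵘ.≃-reflexive (ℚᵘ./-cong (sym (ℤ.pos-* a c)) refl)

module _ (a b c e : ℕ) .{{_ : NonZero b}} .{{_ : NonZero e}} where

  private
    instance
      b*e≢0 : NonZero (b * e)
      b*e≢0 = ℕ.m*n≢0 b e

  /-cross-≡ : a * e ≡ c * b → + a /ℚ b ≡ + c /ℚ e
  /-cross-≡ eq = toℚᵘ-injective
    (ℚᵘ.≃-trans (toℚᵘ-/ a b) (ℚᵘ.≃-trans (/ᵘ-cross-≃ a b c e eq) (ℚᵘ.≃-sym (toℚᵘ-/ c e))))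

  /-cross-≤ : a * e ≤ c * b → + a /ℚ b ≤ℚ + c /ℚ e
  /-cross-≤ le = toℚᵘ-cancel-≤
    (ℚᵘ.≤-respˡ-≃ (ℚᵘ.≃-sym (toℚᵘ-/ a b)) (ℚᵘ.≤-respʳ-≃ (ℚᵘ.≃-sym (toℚᵘ-/ c e)) (/ᵘ-cross-≤ a b c e le)))

  /-cross-< : a * e < c * b → + a /ℚ b <ℚ + c /ℚ e
  /-cross-< lt = toℚᵘ-cancel-<
    (ℚᵘ.<-respˡ-≃ (ℚᵘ.≃-sym (toℚᵘ-/ a b)) (ℚᵘ.<-respʳ-≃ (ℚᵘ.≃-sym (toℚᵘ-/ c e)) (/ᵘ-cross-< a b c e lt)))

  /-+ : + a /ℚ b +ℚ + c /ℚ e ≡ + (a * e + c * b) /ℚ (b * e)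
  /-+ = toℚᵘ-injective (begin
    toℚᵘ (+ a /ℚ b +ℚ + c /ℚ e)               ≈⟨ toℚᵘ-homo-+ (+ a /ℚ b) (+ c /ℚ e) ⟩
    toℚᵘ (+ a /ℚ b) ℚᵘ.+ toℚᵘ (+ c /ℚ e)      ≈⟨ ℚᵘ.+-cong (toℚᵘ-/ a b) (toℚᵘ-/ c e) ⟩
    + a /ᵘ b ℚᵘ.+ + c /ᵘ e                  ≈⟨ /ᵘ-+ a b c e ⟩
    + (a * e + c * b) /ᵘ (b * e)            ≈⟨ toℚᵘ-/ (a * e + c * b) (b * e) ⟨
    toℚᵘ (+ (a * e + c * b) /ℚ (b * e))      ∎)
    where open ℚᵘ.≃-Reasoning

  /-* : (+ a /ℚ b) *ℚ (+ c /ℚ e) ≡ + (a * c) /ℚ (b * e)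
  /-* = toℚᵘ-injective (begin
    toℚᵘ ((+ a /ℚ b) *ℚ (+ c /ℚ e))             ≈⟨ toℚᵘ-homo-* (+ a /ℚ b) (+ c /ℚ e) ⟩
    toℚᵘ (+ a /ℚ b) ℚᵘ.* toℚᵘ (+ c /ℚ e)        ≈⟨ ℚᵘ.*-cong (toℚᵘ-/ a b) (toℚᵘ-/ c e) ⟩
    (+ a /ᵘ b) ℚᵘ.* (+ c /ᵘ e)                ≈⟨ /ᵘ-* a b c e ⟩
    + (a * c) /ᵘ (b * e)                      ≈⟨ toℚᵘ-/ (a * c) (b * e) ⟨
    toℚᵘ (+ (a * c) /ℚ (b * e))                ∎)
    where open ℚᵘ.≃-Reasoning

[a/1]*[1/b]≡a/b : ∀ a b .{{_ : NonZero b}} → (+ a /ℚ 1) *ℚ (+ 1 /ℚ b) ≡ + a /ℚ b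
[a/1]*[1/b]≡a/b a b = trans (/-* a 1 1 b) (/-cross-≡ (a * 1) (1 * b) a b {{ℕ.m*n≢0 1 b}} (cross a b))
  where
  cross : ∀ a b → a * 1 * b ≡ a * (1 * b)
  cross = solve-∀

recip≡1/ : ∀ n .{{_ : NonZero n}} → recip n ≡ + 1 /ℚ n
recip≡1/ (suc n) = refl

recip≢0 : ∀ n .{{_ : NonZero n}} → recip n ≢ 0ℚ
recip≢0 (suc n) eq with normalize-injective-≃ 1 0 (suc n) 1 eq
... | ()

0≤recip : ∀ n .{{_ : NonZero n}} → 0ℚ ≤ℚ recip n
0≤recip n = subst (0ℚ ≤ℚ_) (sym (recip≡1/ n)) (/-cross-≤ 0 1 1 n z≤n)

fromDigits : ℕ → (ℕ → ℕ) → ℕ → ℕ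
fromDigits q c zero    = 0
fromDigits q c (suc n) = fromDigits q c n * q + c (suc n)

expVal≡fromDigits/ : ∀ q c n .{{_ : NonZero q}} → expVal q c n ≡ (+ fromDigits q c n /ℚ q ^ n) {{ℕ.m^n≢0 q n}}
expVal≡fromDigits/ q c zero    = refl
expVal≡fromDigits/ q c (suc n) = begin
  expVal q c n +ℚ (+ cₙ /ℚ 1) *ℚ recip Q
    ≡⟨ cong₂ (λ x y → x +ℚ (+ cₙ /ℚ 1) *ℚ y) (expVal≡fromDigits/ q c n) (recip≡1/ Q) ⟩
  + V /ℚ P +ℚ (+ cₙ /ℚ 1) *ℚ (+ 1 /ℚ Q)
    ≡⟨ cong (+ V /ℚ P +ℚ_) ([a/1]*[1/b]≡a/b cₙ Q) ⟩
  + V /ℚ P +ℚ + cₙ /ℚ Q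
    ≡⟨ /-+ V P cₙ Q ⟩
  + (V * Q + cₙ * P) /ℚ (P * Q)
    ≡⟨ /-cross-≡ (V * Q + cₙ * P) (P * Q) (V * q + cₙ) Q (cross V q P cₙ) ⟩
  + (V * q + cₙ) /ℚ Q ∎
  where
  open ≡-Reasoning
  cₙ = c (suc n)
  V = fromDigits q c n
  P = q ^ n
  Q = q ^ suc n
  instance
    P≢0 : NonZero P
    P≢0 = ℕ.m^n≢0 q n
    Q≢0 : NonZero Q
    Q≢0 = ℕ.m^n≢0 q (suc n)
    PQ≢0 : NonZero (P * Q)
    PQ≢0 = ℕ.m*n≢0 P Q
  cross : ∀ V q P c → (V * (q * P) + c * P) * (q * P) ≡ (V * q + c) * (P * (q * P))
  cross = solve-∀

expVal-truncate : ∀ q c d n → d ≤ n → (∀ j → d < j → j ≤ n → c j ≡ 0) → expVal q c n ≡ expVal q c d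
expVal-truncate q c d zero    z≤n _ = refl
expVal-truncate q c d (suc n) d≤1+n zeros with ℕ.m≤n⇒m<n∨m≡n d≤1+n
... | inj₂ refl = refl
... | inj₁ (s≤s d≤n) = begin
  expVal q c n +ℚ (+ c (suc n) /ℚ 1) *ℚ recip (q ^ suc n)
    ≡⟨ cong (λ t → expVal q c n +ℚ (+ t /ℚ 1) *ℚ recip (q ^ suc n)) (zeros (suc n) (s≤s d≤n) ℕ.≤-refl) ⟩
  expVal q c n +ℚ 0ℚ *ℚ recip (q ^ suc n)
    ≡⟨ cong (expVal q c n +ℚ_) (ℚ.*-zeroˡ (recip (q ^ suc n))) ⟩
  expVal q c n +ℚ 0ℚ
    ≡⟨ ℚ.+-identityʳ (expVal q c n) ⟩
  expVal q c n
    ≡⟨ expVal-truncate q c d n d≤n (λ j d<j j≤n → zeros j d<j (ℕ.m≤n⇒m≤1+n j≤n)) ⟩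
  expVal q c d ∎
  where open ≡-Reasoning

-- The n base-q digits of N are indexed j = 1 … n, most significant first, as in expVal.
digit : (q : ℕ) .{{_ : NonZero q}} → ℕ → ℕ → ℕ → ℕ
digit q N n j = (N / q ^ (n ∸ j)) {{ℕ.m^n≢0 q (n ∸ j)}} % q

module _ (q : ℕ) .{{_ : NonZero q}} (N n : ℕ) where

  digit-< : ∀ j → digit q N n j < q
  digit-< j = m%n<n _ q

  digit-last : digit q N n n ≡ N % q
  digit-last = begin
    (N / q ^ (n ∸ n)) {{_}} % q ≡⟨ cong (_% q) (/-congʳ {{ℕ.m^n≢0 q (n ∸ n)}} (cong (q ^_) (ℕ.n∸n≡0 n))) ⟩
    N / 1 % q                   ≡⟨ cong (_% q) (n/1≡n N) ⟩
    N % q                       ∎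
    where open ≡-Reasoning

  fromDigits-digit-prefix : N < q ^ n → ∀ k e → k + e ≡ n →
                            fromDigits q (digit q N n) k ≡ (N / q ^ e) {{ℕ.m^n≢0 q e}}
  fromDigits-digit-prefix N<qⁿ zero e refl = sym (m<n⇒m/n≡0 {{ℕ.m^n≢0 q e}} N<qⁿ)
  fromDigits-digit-prefix N<qⁿ (suc k) e k+e≡n = begin
    fromDigits q (digit q N n) k * q + digit q N n (suc k)
      ≡⟨ cong₂ (λ x y → x * q + y)
           (fromDigits-digit-prefix N<qⁿ k (suc e) (trans (ℕ.+-suc k e) k+e≡n))
           (cong (_% q) (/-congʳ {{ℕ.m^n≢0 q (n ∸ suc k)}} (cong (q ^_) n∸[1+k]≡e))) ⟩
    (N / q ^ suc e) * q + M % q ≡⟨ cong (λ x → x * q + M % q) /-q^suc ⟩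
    M / q * q + M % q           ≡⟨ ℕ.+-comm (M / q * q) (M % q) ⟩
    M % q + M / q * q           ≡⟨ m≡m%n+[m/n]*n M q ⟨
    M                           ∎
    where
    open ≡-Reasoning
    instance
      q^e≢0 : NonZero (q ^ e)
      q^e≢0 = ℕ.m^n≢0 q e
      q^1+e≢0 : NonZero (q ^ suc e)
      q^1+e≢0 = ℕ.m^n≢0 q (suc e)
    M = N / q ^ e
    n∸[1+k]≡e : n ∸ suc k ≡ e
    n∸[1+k]≡e = trans (cong (_∸ suc k) (sym k+e≡n)) (ℕ.m+n∸m≡n (suc k) e)
    /-q^suc : N / q ^ suc e ≡ M / q
    /-q^suc = sym (trans (m/n/o≡m/[n*o] N (q ^ e) q {{_}} {{_}} {{ℕ.m*n≢0 (q ^ e) q}})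
                         (/-congʳ {{ℕ.m*n≢0 (q ^ e) q}} (ℕ.*-comm (q ^ e) q)))

  fromDigits-digit : N < q ^ n → fromDigits q (digit q N n) n ≡ N
  fromDigits-digit N<qⁿ = trans (fromDigits-digit-prefix N<qⁿ n 0 (ℕ.+-identityʳ n)) (n/1≡n N)

  digit-isExpansion : N < q ^ n → IsExpansion q ((+ N /ℚ q ^ n) {{ℕ.m^n≢0 q n}}) n (digit q N n)
  digit-isExpansion N<qⁿ =
      (λ j _ _ → digit-< j)
    , trans (cong (λ t → (+ t /ℚ q ^ n) {{ℕ.m^n≢0 q n}}) (sym (fromDigits-digit N<qⁿ)))
            (sym (expVal≡fromDigits/ q _ n))

coprime-1ʳ : ∀ a → Coprime a 1
coprime-1ʳ a (_ , i∣1) = ∣1⇒≡1 i∣1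

coprime-*ʳ : ∀ {a b c} → Coprime a b → Coprime a c → Coprime a (b * c)
coprime-*ʳ a⊥b a⊥c (i∣a , i∣bc) =
  a⊥c (i∣a , coprime-divisor (λ (j∣i , j∣b) → a⊥b (∣-trans j∣i i∣a , j∣b)) i∣bc)

coprime-^ʳ : ∀ {a b} n → Coprime a b → Coprime a (b ^ n)
coprime-^ʳ {a} zero    _   = coprime-1ʳ a
coprime-^ʳ     (suc n) a⊥b = coprime-*ʳ a⊥b (coprime-^ʳ n a⊥b)

coprime-^ : ∀ {a b} m n → Coprime a b → Coprime (a ^ m) (b ^ n)
coprime-^ m n a⊥b = Coprime.sym (coprime-^ʳ m (Coprime.sym (coprime-^ʳ n a⊥b)))

coprime-prodFinʳ : ∀ {a} m (f : Fin m → ℕ) → (∀ i → Coprime a (f i)) → Coprime a (prodFin m f)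
coprime-prodFinʳ {a} zero    f _   = coprime-1ʳ a
coprime-prodFinʳ     (suc m) f a⊥f =
  coprime-*ʳ (a⊥f Fin.zero) (coprime-prodFinʳ m (λ i → f (Fin.suc i)) (λ i → a⊥f (Fin.suc i)))

prime≢⇒coprime : ∀ {p q} → Prime p → Prime q → p ≢ q → Coprime p q
prime≢⇒coprime {p} {q} p-prime q-prime p≢q {i} (i∣p , i∣q)
  with prime⇒irreducible p-prime i∣p | prime⇒irreducible q-prime i∣q
... | inj₁ i≡1  | _        = i≡1
... | inj₂ _    | inj₁ i≡1 = i≡1
... | inj₂ refl | inj₂ i≡q = ⊥-elim (p≢q i≡q)

^-distribʳ-* : ∀ m n k → (m * n) ^ k ≡ m ^ k * n ^ k
^-distribʳ-* m n zero    = refl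
^-distribʳ-* m n (suc k) = begin
  m * n * (m * n) ^ k     ≡⟨ cong (m * n *_) (^-distribʳ-* m n k) ⟩
  m * n * (m ^ k * n ^ k) ≡⟨ swap m n (m ^ k) (n ^ k) ⟩
  m * m ^ k * (n * n ^ k) ∎
  where
  open ≡-Reasoning
  swap : ∀ a b x y → a * b * (x * y) ≡ a * x * (b * y)
  swap = solve-∀

1<prime^ : ∀ {p} α → Prime p → 0 < α → 1 < p ^ α
1<prime^ {p} (suc α) p-prime _ =
  ℕ.*-mono-≤ (nonTrivial⇒n>1 p {{prime⇒nonTrivial p-prime}}) (ℕ.m^n>0 p {{prime⇒nonZero p-prime}} α)

prodFin-cong : ∀ m {f g : Fin m → ℕ} → (∀ i → f i ≡ g i) → prodFin m f ≡ prodFin m g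
prodFin-cong zero    _   = refl
prodFin-cong (suc m) f≗g = cong₂ _*_ (f≗g Fin.zero) (prodFin-cong m (λ i → f≗g (Fin.suc i)))

prodFin-* : ∀ m (f g : Fin m → ℕ) → prodFin m (λ i → f i * g i) ≡ prodFin m f * prodFin m g
prodFin-* zero    f g = refl
prodFin-* (suc m) f g = begin
  f₀ * g₀ * prodFin m (λ i → f (Fin.suc i) * g (Fin.suc i))
    ≡⟨ cong (f₀ * g₀ *_) (prodFin-* m (λ i → f (Fin.suc i)) (λ i → g (Fin.suc i))) ⟩
  f₀ * g₀ * (prodFin m (λ i → f (Fin.suc i)) * prodFin m (λ i → g (Fin.suc i)))
    ≡⟨ swap f₀ g₀ _ _ ⟩
  f₀ * prodFin m (λ i → f (Fin.suc i)) * (g₀ * prodFin m (λ i → g (Fin.suc i))) ∎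
  where
  open ≡-Reasoning
  f₀ = f Fin.zero
  g₀ = g Fin.zero
  swap : ∀ a b x y → a * b * (x * y) ≡ a * x * (b * y)
  swap = solve-∀

prodFin-pos : ∀ m (f : Fin m → ℕ) → (∀ i → 0 < f i) → 0 < prodFin m f
prodFin-pos zero    f _   = z<s
prodFin-pos (suc m) f f>0 = ℕ.*-mono-≤ (f>0 Fin.zero) (prodFin-pos m (λ i → f (Fin.suc i)) (λ i → f>0 (Fin.suc i)))

below above : ∀ {m} → ℕ → (Fin m → ℕ) → Fin m → ℕ
below k f i = if toℕ i <ᵇ k then f i else 1
above k f i = if toℕ i <ᵇ k then 1 else f i

module _ {m : ℕ} (k : ℕ) (f : Fin m → ℕ) where

  below-pos : (∀ i → 0 < f i) → ∀ i → 0 < below k f i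
  below-pos f>0 i with toℕ i <ᵇ k
  ... | true  = f>0 i
  ... | false = z<s

  above-pos : (∀ i → 0 < f i) → ∀ i → 0 < above k f i
  above-pos f>0 i with toℕ i <ᵇ k
  ... | true  = z<s
  ... | false = f>0 i

  prodFin-below*above : prodFin m f ≡ prodFin m (below k f) * prodFin m (above k f)
  prodFin-below*above = trans (prodFin-cong m below*above) (prodFin-* m (below k f) (above k f))
    where
    below*above : ∀ i → f i ≡ below k f i * above k f i
    below*above i with toℕ i <ᵇ k
    ... | true  = sym (ℕ.*-identityʳ (f i))
    ... | false = sym (ℕ.+-identityʳ (f i))

  coprime-below-above : (∀ i j → i ≢ j → Coprime (f i) (f j)) →
                        Coprime (prodFin m (below k f)) (prodFin m (above k f))
  coprime-below-above f-coprime = Coprime.sym (coprime-prodFinʳ m (below k f) λ i →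
    Coprime.sym (coprime-prodFinʳ m (above k f) λ j → factors-coprime i j))
    where
    factors-coprime : ∀ i j → Coprime (below k f i) (above k f j)
    factors-coprime i j with toℕ i <ᵇ k in i<k | toℕ j <ᵇ k in j<k
    ... | false | _     = Coprime.sym (coprime-1ʳ _)
    ... | true  | true  = coprime-1ʳ _
    ... | true  | false = f-coprime i j λ { refl → not-¬ i<k j<k }

1<prodFin-below : ∀ m k (f : Fin m → ℕ) → 0 < m → 0 < k → (∀ i → 1 < f i) → 1 < prodFin m (below k f)
1<prodFin-below (suc m) (suc k) f _ _ 1<f =
  ℕ.*-mono-≤ (1<f Fin.zero)
    (prodFin-pos m (λ i → below (suc k) f (Fin.suc i))
      (λ i → below-pos (suc k) f (λ j → ℕ.<-trans z<s (1<f j)) (Fin.suc i)))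

IsLeastWithTau : (q r d : ℕ) → ℚ → Set
IsLeastWithTau q r d x =
  (D q x × x ≢ 0ℚ × TauIs r x d) × (∀ y → D q y → y ≢ 0ℚ → TauIs r y d → x ≤ℚ y)

module _ (U : ℕ) .{{_ : NonZero U}} (1<U : 1 < U) (d : ℕ) (0<d : 0 < d) where

  private
    instance
      Uᵈ≢0 : NonZero (U ^ d)
      Uᵈ≢0 = ℕ.m^n≢0 U d

  recip-pow<1 : recip (U ^ d) <ℚ 1ℚ
  recip-pow<1 = subst (_<ℚ 1ℚ) (sym (recip≡1/ (U ^ d)))
    (/-cross-< 1 (U ^ d) 1 1 (subst (1 <_) (sym (ℕ.*-identityˡ _)) (ℕ.^-monoʳ-< U 1<U 0<d)))

  recip-pow∈D : D U (recip (U ^ d))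
  recip-pow∈D = 0≤recip (U ^ d) , recip-pow<1 , d , digit U 1 d ,
    subst (λ x → IsExpansion U x d (digit U 1 d)) (sym (recip≡1/ (U ^ d)))
      (digit-isExpansion U 1 d (ℕ.^-monoʳ-< U 1<U 0<d))

  module _ (V : ℕ) .{{_ : NonZero V}} (U⊥V : Coprime U V) where

    private
      r = U * V
      instance
        r≢0 : NonZero r
        r≢0 = ℕ.m*n≢0 U V
        rᵈ≢0 : NonZero (r ^ d)
        rᵈ≢0 = ℕ.m^n≢0 r d

    recip-pow≡ : recip (U ^ d) ≡ + V ^ d /ℚ r ^ d
    recip-pow≡ = trans (recip≡1/ (U ^ d)) (/-cross-≡ 1 (U ^ d) (V ^ d) (r ^ d)
      (trans (ℕ.*-identityˡ (r ^ d)) (trans (^-distribʳ-* U V d) (ℕ.*-comm (U ^ d) (V ^ d)))))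

    recip-pow-tau : TauIs r (recip (U ^ d)) d
    recip-pow-tau = 0≤recip (U ^ d) , recip-pow<1 , 0<d , d , digit r (V ^ d) d ,
      subst (λ x → IsExpansion r x d (digit r (V ^ d) d)) (sym recip-pow≡)
        (digit-isExpansion r (V ^ d) d (ℕ.^-monoˡ-< d {{>-nonZero 0<d}} V<r)) ,
      ℕ.≤-refl , last-digit≢0 , λ j d<j j≤d → ⊥-elim (ℕ.<⇒≱ d<j j≤d)
      where
      V<r : V < r
      V<r = subst (V <_) (ℕ.*-comm V U) (ℕ.m<m*n V U 1<U)
      last-digit≢0 : digit r (V ^ d) d d ≢ 0
      last-digit≢0 eq = ℕ.<⇒≢ 1<U (sym (coprime-^ʳ d U⊥V (∣-refl , U∣Vᵈ)))
        where
        U∣Vᵈ : U ∣ V ^ d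
        U∣Vᵈ = ∣-trans (divides V (ℕ.*-comm U V))
                       (m%n≡0⇒n∣m (V ^ d) r (trans (sym (digit-last r (V ^ d) d)) eq))

    recip-pow-least : ∀ x → D U x → x ≢ 0ℚ → TauIs r x d → recip (U ^ d) ≤ℚ x
    recip-pow-least x (_ , _ , n , c , _ , x≡) x≢0 (_ , _ , _ , n′ , c′ , (_ , x≡′) , d≤n′ , _ , zeros) =
      subst₂ _≤ℚ_ (sym recip-pow≡) (sym x≡B/rᵈ)
        (/-cross-≤ (V ^ d) (r ^ d) B (r ^ d) (ℕ.*-monoˡ-≤ (r ^ d) Vᵈ≤B))
      where
      instance
        Uⁿ≢0 : NonZero (U ^ n)
        Uⁿ≢0 = ℕ.m^n≢0 U n
      A = fromDigits U c n
      B = fromDigits r c′ d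
      x≡B/rᵈ : x ≡ + B /ℚ r ^ d
      x≡B/rᵈ = trans x≡′ (trans (expVal-truncate r c′ d n′ d≤n′ zeros) (expVal≡fromDigits/ r c′ d))
      Aʳᵈ≡BUⁿ : A * r ^ d ≡ B * U ^ n
      Aʳᵈ≡BUⁿ = normalize-injective-≃ A B (U ^ n) (r ^ d)
        (trans (sym (trans x≡ (expVal≡fromDigits/ U c n))) x≡B/rᵈ)
      Vᵈ∣UⁿB : V ^ d ∣ U ^ n * B
      Vᵈ∣UⁿB = divides (A * U ^ d) (begin
        U ^ n * B            ≡⟨ ℕ.*-comm (U ^ n) B ⟩
        B * U ^ n            ≡⟨ Aʳᵈ≡BUⁿ ⟨
        A * r ^ d            ≡⟨ cong (A *_) (^-distribʳ-* U V d) ⟩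
        A * (U ^ d * V ^ d)  ≡⟨ ℕ.*-assoc A (U ^ d) (V ^ d) ⟨
        A * U ^ d * V ^ d    ∎)
        where open ≡-Reasoning
      B≢0 : B ≢ 0
      B≢0 B≡0 = x≢0 (trans x≡B/rᵈ (/-cross-≡ B (r ^ d) 0 1 (cong (_* 1) B≡0)))
      Vᵈ≤B : V ^ d ≤ B
      Vᵈ≤B = ∣⇒≤ {{≢-nonZero B≢0}} (coprime-divisor (coprime-^ d n (Coprime.sym U⊥V)) Vᵈ∣UⁿB)

    recip-pow-isLeastWithTau : IsLeastWithTau U r d (recip (U ^ d))
    recip-pow-isLeastWithTau = (recip-pow∈D , recip≢0 (U ^ d) , recip-pow-tau) , recip-pow-least

lemma4p3 : (r s m k : ℕ) (ps αs : Fin m → ℕ) (d : ℕ) →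
    2 ≤ r → 2 ≤ s → 0 < k → k < m →
    (∀ i → Prime (ps i)) → Injective _≡_ _≡_ ps → (∀ i → 1 ≤ αs i) →
    r ≡ prodFin m (λ i → ps i ^ αs i) →
    (∀ p → Prime p → (p ∣ gcd r s) ⇔ (∃ λ i → (toℕ i < k) × (ps i ≡ p))) →
    0 < d →
    let u = prodFin m (λ i → if toℕ i <ᵇ k then ps i ^ αs i else 1) in
    (D u (recip (u ^ d)) × recip (u ^ d) ≢ 0ℚ × TauIs r (recip (u ^ d)) d) ×
    (∀ x → D u x → x ≢ 0ℚ → TauIs r x d → recip (u ^ d) ≤ℚ x)
lemma4p3 r s m k ps αs d _ _ 0<k k<m ps-prime ps-injective 0<αs r≡ _ 0<d =
  subst (λ r → IsLeastWithTau u r d (recip (u ^ d))) (sym (trans r≡ (prodFin-below*above k f)))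
    (recip-pow-isLeastWithTau u {{>-nonZero (ℕ.<-trans z<s 1<u)}} 1<u d 0<d v {{>-nonZero 0<v}} u⊥v)
  where
  f : Fin m → ℕ
  f i = ps i ^ αs i
  u = prodFin m (below k f)
  v = prodFin m (above k f)
  1<f : ∀ i → 1 < f i
  1<f i = 1<prime^ (αs i) (ps-prime i) (0<αs i)
  1<u : 1 < u
  1<u = 1<prodFin-below m k f (ℕ.<-trans 0<k k<m) 0<k 1<f
  0<v : 0 < v
  0<v = prodFin-pos m (above k f) (above-pos k f (λ i → ℕ.<-trans z<s (1<f i)))
  u⊥v : Coprime u v
  u⊥v = coprime-below-above k f λ i j i≢j →
    coprime-^ (αs i) (αs j) (prime≢⇒coprime (ps-prime i) (ps-prime j) (λ pᵢ≡pⱼ → i≢j (ps-injective pᵢ≡pⱼ)))
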